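{- Let $D$ be a propositional defeasible theory with $\Delta$ closure $P_\Delta$ and $\partial_{||}$ closure $P_{\partial_{||}}$, and let $p$ be a literal. Then: 1. If $+\Delta p\notin P_\Delta$ and $+\Delta{\sim}p\in P_\Delta$, then $+\partial_{||}p\notin P_{\partial_{||}}$. 2. If $-\Delta p\in P_\Delta$ and $+\Delta{\sim}p\in P_\Delta$, then $-\partial_{||}p\in P_{\partial_{||}}$. 3. If $+\Delta p\notin P_\Delta$ and $+\Delta{\sim}p\notin P_\Delta$, then it is not the case that both $+\partial_{||}p\in P_{\partial_{||}}$ and $+\partial_{||}{\sim}p\in P_{\partial_{||}}$.
   Context: Literals are propositions or their negations; ${\sim}q$ is the complement of $q$. A propositional defeasible theory is $D=(F,R,>)$: $F$ finite set of literals, $R$ finite set of rules, $>$ acyclic binary relation on $R$. Each rule has a finite antecedent set $A(r)$ and consequent literal and is strict ($\rightarrow$), defeasible ($\Rightarrow$) or a defeater ($\leadsto$). $R_s$: strict rules; $R_{sd}$: strict and defeasible rules; $R[q]$: rules with consequent $q$. A proof $P$ is a sequence of tagged literals, $P(1..i)$ its first $i$ elements. $+\Delta$: append $+\Delta q$ if $q\in F$ or some $r\in R_s[q]$ has $+\Delta a\in P(1..i)$ for all $a\in A(r)$. $-\Delta$: append $-\Delta q$ if $q\notin F$ and every $r\in R_s[q]$ has some $a\in A(r)$ with $-\Delta a\in P(1..i)$. $P_\Delta$: set of all $\pm\Delta$ conclusions derivable from $D$. $+\lambda$: append $+\lambda q$ if $+\Delta q\in P_\Delta$, or some $r\in R_{sd}[q]$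 has $+\lambda a\in P(1..i)$ for all $a\in A(r)$ and $+\Delta{\sim}q\notin P_\Delta$. $-\lambda$: append $-\lambda q$ if $-\Delta q\in P_\Delta$ and either every $r\in R_{sd}[q]$ has some $a\in A(r)$ with $-\lambda a\in P(1..i)$, or $+\Delta{\sim}q\in P_\Delta$. $P_\lambda$: all $\pm\lambda$ conclusions derivable. $+\partial_{||}$: append $+\partial_{||}q$ if (1) $+\Delta q\in P_\Delta$, or (2.1) some $r\in R_{sd}[q]$ has $+\partial_{||}a\in P(1..i)$ for all $a\in A(r)$, (2.2) $+\Delta{\sim}q\notin P_\Delta$, and (2.3) every $s\in R[{\sim}q]$ satisfies (2.3.1) some $a\in A(s)$ has $+\lambda a\notin P_\lambda$, or (2.3.2) some $t\in R_{sd}[q]$ with $t>s$ has $+\partial_{||}a\in P(1..i)$ for all $a\in A(t)$. $-\partial_{||}$: append $-\partial_{||}q$ if (1) $-\Delta q\in P_\Delta$ and (2) either (2.1) every $r\in R_{sd}[q]$ has some $a\in A(r)$ with $-\partial_{||}a\in P(1..i)$, or (2.2) $+\Delta{\sim}q\in P_\Delta$, or (2.3) some $s\in R[{\sim}q]$ has $+\lambda a\in P_\lambda$ for all $a\in A(s)$ and every $t\in R_{sd}[q]$ either has some $a\in A(t)$ with $-\partial_{||}a\in P(1..i)$ or not $t>s$. $P_{\partial_{||}}$ is the set of all $\pm\partial_{||}$ conclusions derivable from $D$. -}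

module Defs where

open import Data.Nat using (ℕ)
open import Data.Fin using (Fin)
open import Data.List using (List; []; _∷_)
open import Data.List.Membership.Propositional using (_∈_; _∉_)
open import Data.List.Relation.Unary.All using (All)
open import Data.List.Relation.Unary.Any using (Any)
open import Data.Product using (Σ; _×_; _,_)
open import Data.Sum using (_⊎_)
open import Relation.Nullary using (¬_)
open import Relation.Binary.PropositionalEquality using (_≡_)
open import Relation.Binary.Construct.Closure.Transitive using (TransClosure)

data Lit (Atom : Set) : Set where
  pos : Atom → Lit Atom
  neg : Atom → Lit Atom

∼_ : {Atom : Set} → Lit Atom → Lit Atom
∼ pos a = neg a
∼ neg a = pos a

data Kind : Set where
  strict defeasible defeater : Kind

record Rule (Atom : Set) : Set where
  field
    ant  : List (Lit Atom)
    con  : Lit Atom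
    kind : Kind
open Rule public

data IsStrict {Atom : Set} (r : Rule Atom) : Set where
  isStrict : kind r ≡ strict → IsStrict r

data IsSD {Atom : Set} (r : Rule Atom) : Set where
  sdStrict     : kind r ≡ strict → IsSD r
  sdDefeasible : kind r ≡ defeasible → IsSD r

record Theory (Atom : Set) : Set₁ where
  field
    F       : List (Lit Atom)
    n       : ℕ
    rule    : Fin n → Rule Atom
    _≻_     : Fin n → Fin n → Set
    acyclic : ∀ i → ¬ TransClosure _≻_ i i
open Theory public

data Sign : Set where
  plus minus : Sign

Tagged : Set → Set
Tagged Atom = Sign × Lit Atom

-- A proof (given as the list of its elements, most recent first) is valid for
-- a step condition if each element satisfies the condition w.r.t. the elements
-- before it (i.e. the prefix P(1..i)).
data Valid {Atom : Set} (Step : List (Tagged Atom) → Tagged Atom → Set) :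
           List (Tagged Atom) → Set where
  []  : Valid Step []
  _∷_ : ∀ {t P} → Step P t → Valid Step P → Valid Step (t ∷ P)

Closure : {Atom : Set} → (List (Tagged Atom) → Tagged Atom → Set) → Tagged Atom → Set
Closure {Atom} Step t = Σ (List (Tagged Atom)) λ P → Valid Step P × t ∈ P

module _ {Atom : Set} (D : Theory Atom) where

  private
    R = Fin (n D)
    A : R → List (Lit Atom)
    A r = ant (rule D r)
    C : R → Lit Atom
    C r = con (rule D r)
    _>_ : R → R → Set
    _>_ = _≻_ D

  ΔStep : List (Tagged Atom) → Tagged Atom → Set
  ΔStep P (plus , q)  =
    q ∈ F D
    ⊎ Σ R (λ r → IsStrict (rule D r) × C r ≡ q × All (λ a → (plus , a) ∈ P) (A r))
  ΔStep P (minus , q) =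
    q ∉ F D
    × (∀ r → IsStrict (rule D r) → C r ≡ q → Any (λ a → (minus , a) ∈ P) (A r))

  PΔ : Tagged Atom → Set
  PΔ = Closure ΔStep

  λStep : List (Tagged Atom) → Tagged Atom → Set
  λStep P (plus , q)  =
    PΔ (plus , q)
    ⊎ (Σ R (λ r → IsSD (rule D r) × C r ≡ q × All (λ a → (plus , a) ∈ P) (A r))
       × ¬ PΔ (plus , ∼ q))
  λStep P (minus , q) =
    PΔ (minus , q)
    × ((∀ r → IsSD (rule D r) → C r ≡ q → Any (λ a → (minus , a) ∈ P) (A r))
       ⊎ PΔ (plus , ∼ q))

  Pλ : Tagged Atom → Set
  Pλ = Closure λStep

  ∂Step : List (Tagged Atom) → Tagged Atom → Set
  ∂Step P (plus , q)  =
    PΔ (plus , q)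
    ⊎ (Σ R (λ r → IsSD (rule D r) × C r ≡ q × All (λ a → (plus , a) ∈ P) (A r))
       × ¬ PΔ (plus , ∼ q)
       × (∀ s → C s ≡ ∼ q →
            Any (λ a → ¬ Pλ (plus , a)) (A s)
            ⊎ Σ R (λ t → IsSD (rule D t) × C t ≡ q × (t > s)
                         × All (λ a → (plus , a) ∈ P) (A t))))
  ∂Step P (minus , q) =
    PΔ (minus , q)
    × ((∀ r → IsSD (rule D r) → C r ≡ q → Any (λ a → (minus , a) ∈ P) (A r))
       ⊎ PΔ (plus , ∼ q)
       ⊎ Σ R (λ s → C s ≡ ∼ q × All (λ a → Pλ (plus , a)) (A s)
                    × (∀ t → IsSD (rule D t) → C t ≡ q →
                         Any (λ a → (minus , a) ∈ P) (A t) ⊎ ¬ (t > s))))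

  P∂ : Tagged Atom → Set
  P∂ = Closure ∂Step

module Submission where

-- Parts 1 and 2 are immediate from the inference conditions:
-- a +∂_||p step is either a +Δp fact or requires +Δ∼p to be unprovable, and
-- -∂_||p may always be concluded in one step from -Δp and +Δ∼p (clause 2.2).
--
-- If neither p nor ∼p is definitely provable,
-- a +∂_|| conclusion for p comes from clause (2): some applicable rule for p
-- exists, and every applicable rule for ∼p is beaten by a stronger
-- applicable rule for p (applicable antecedents are +∂_||-provable, hence
-- +λ-provable, so clause 2.3.1 cannot excuse them).  If the same holds for
-- ∼p, then starting from an applicable rule for p we can climb forever
-- through strictly ≻-greater applicable rules, which is impossible because
-- ≻ is an acyclic relation on finitely many rules.

open import Defs
open import Data.Product using (Σ; _×_; _,_; proj₁; proj₂)
open import Data.Sum using (_⊎_; inj₁; inj₂)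
open import Data.Empty using (⊥-elim)
open import Data.Nat using (ℕ; zero; suc; _<_; s≤s)
open import Data.Nat.Properties using (m≤n⇒m<n∨m≡n; ≤-refl)
open import Data.Fin using (Fin; toℕ)
open import Data.Fin.Properties using (pigeonhole)
open import Data.List using (List; []; _∷_)
open import Data.List.Membership.Propositional using (_∈_)
open import Data.List.Relation.Unary.All as All using (All; _∷_)
open import Data.List.Relation.Unary.Any using (Any; here; there)
open import Relation.Nullary using (¬_)
open import Relation.Binary.PropositionalEquality using (_≡_; refl; sym; trans; subst)
open import Relation.Binary.Construct.Closure.Transitive using (TransClosure; [_]; _∷_)

∼-involutive : {Atom : Set} (q : Lit Atom) → ∼ (∼ q) ≡ q
∼-involutive (pos a) = refl
∼-involutive (neg a) = refl

module _ {Atom : Set} {Step : List (Tagged Atom) → Tagged Atom → Set} where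

  justified : ∀ {P t} → Valid Step P → t ∈ P →
              Σ (List (Tagged Atom)) λ Q → Valid Step Q × Step Q t
  justified (s ∷ v) (here refl) = _ , v , s
  justified (s ∷ v) (there t∈P) = justified v t∈P

  closed : ∀ {P : List (Tagged Atom)} {Lits : List (Lit Atom)} →
           Valid Step P → All (λ a → (plus , a) ∈ P) Lits →
           All (λ a → Closure Step (plus , a)) Lits
  closed v = All.map (λ a∈P → _ , v , a∈P)

-- An acyclic relation on a finite set admits no endless ascent: no nonempty
-- property G is such that every element satisfying G has a strictly
-- ≻-greater element satisfying G.  (Iterate the ascent n+1 times; by the
-- pigeonhole principle some element repeats, closing a ≻-cycle.)
module _ {n : ℕ} {_≻_ : Fin n → Fin n → Set}
         (acyclic : ∀ i → ¬ TransClosure _≻_ i i)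
         (G : Fin n → Set)
         (ascend : ∀ x → G x → Σ (Fin n) λ y → y ≻ x × G y) where

  private
    climb : Σ (Fin n) G → Σ (Fin n) G
    climb (x , gx) = proj₁ (ascend x gx) , proj₂ (proj₂ (ascend x gx))

    climbs : ∀ g → proj₁ (climb g) ≻ proj₁ g
    climbs (x , gx) = proj₁ (proj₂ (ascend x gx))

    walk : Σ (Fin n) G → ℕ → Σ (Fin n) G
    walk g zero    = g
    walk g (suc k) = climb (walk g k)

    walk-ascends : ∀ g i j → i < j →
                   TransClosure _≻_ (proj₁ (walk g j)) (proj₁ (walk g i))
    walk-ascends g i (suc j) (s≤s i≤j) with m≤n⇒m<n∨m≡n i≤j
    ... | inj₁ i<j  = climbs (walk g j) ∷ walk-ascends g i j i<j
    ... | inj₂ refl = [ climbs (walk g j) ]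

  no-endless-ascent : ¬ Σ (Fin n) G
  no-endless-ascent g
    with i , j , i<j , same ← pigeonhole ≤-refl (λ (k : Fin (suc n)) → proj₁ (walk g (toℕ k)))
    = acyclic _ (subst (λ z → TransClosure _≻_ z (proj₁ (walk g (toℕ i))))
                       (sym same) (walk-ascends g (toℕ i) (toℕ j) i<j))

module _ {Atom : Set} (D : Theory Atom) where

  private
    R = Fin (n D)
    A : R → List (Lit Atom)
    A r = ant (rule D r)
    C : R → Lit Atom
    C r = con (rule D r)
    _>_ : R → R → Set
    _>_ = _≻_ D

  -- Keeping only the positive conclusions of a ∂_|| proof yields a λ proof:
  -- the +λ conditions are those of +∂_|| without the attack clause (2.3).
  positive-part : ∀ {P} → Valid (∂Step D) P →
    Σ (List (Tagged Atom)) λ Q → Valid (λStep D) Q × (∀ {a} → (plus , a) ∈ P → (plus , a) ∈ Q)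
  positive-part [] = [] , [] , λ ()
  positive-part (_∷_ {minus , q} _ v) with Q , w , keep ← positive-part v =
    Q , w , λ { (there a∈P) → keep a∈P }
  positive-part (_∷_ {plus , q} {P} step v) with Q , w , keep ← positive-part v =
    (plus , q) ∷ Q , as-λ step ∷ w , λ { (here refl) → here refl ; (there a∈P) → there (keep a∈P) }
    where
    as-λ : ∂Step D P (plus , q) → λStep D Q (plus , q)
    as-λ (inj₁ definite)                       = inj₁ definite
    as-λ (inj₂ ((r , sd , c , ants) , nd , _)) = inj₂ ((r , sd , c , All.map keep ants) , nd)

  ∂⁺⇒λ⁺ : ∀ {a} → P∂ D (plus , a) → Pλ D (plus , a)
  ∂⁺⇒λ⁺ (P , v , a∈P) with Q , w , keep ← positive-part v = Q , w , keep a∈P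

  Applicable : R → Set
  Applicable r = All (λ a → P∂ D (plus , a)) (A r)

  -- +∂_||-provable antecedents cannot discard a rule via clause 2.3.1,
  -- since they are even +λ-provable.
  applicable-not-discarded : ∀ {as} → All (λ a → P∂ D (plus , a)) as →
                             ¬ Any (λ a → ¬ Pλ D (plus , a)) as
  applicable-not-discarded (a ∷ _) (here not-λ) = not-λ (∂⁺⇒λ⁺ a)
  applicable-not-discarded (_ ∷ as) (there any) = applicable-not-discarded as any

  Overrides : Lit Atom → Set
  Overrides q = ∀ s → C s ≡ ∼ q → Applicable s → Σ R λ t → C t ≡ q × t > s × Applicable t

  -- Inversion of +∂_||q when +Δq fails: the last step used clause (2), so
  -- +Δ∼q fails, some applicable rule for q exists, and q overrides ∼q.
  ∂⁺-inversion : ∀ {q} → P∂ D (plus , q) → ¬ PΔ D (plus , q) →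
    ¬ PΔ D (plus , ∼ q) × Σ R (λ r → C r ≡ q × Applicable r) × Overrides q
  ∂⁺-inversion {q} (P , v , q∈P) not-Δ with justified v q∈P
  ... | _ , _ , inj₁ definite = ⊥-elim (not-Δ definite)
  ... | Q , w , inj₂ ((r , _ , c , ants) , not-Δ∼ , attacks) =
    not-Δ∼ , (r , c , closed w ants) , overrides
    where
    overrides : Overrides q
    overrides s c′ app with attacks s c′
    ... | inj₁ discarded = ⊥-elim (applicable-not-discarded app discarded)
    ... | inj₂ (t , _ , ct , t>s , ants′) = t , ct , t>s , closed w ants′

  -- If p and ∼p override each other, there is no applicable rule for p:
  -- alternating between them gives an endless ≻-ascent among the
  -- applicable rules for p or ∼p.
  no-mutual-override : ∀ p → Overrides p → Overrides (∼ p) →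
                       ¬ Σ R (λ r → C r ≡ p × Applicable r)
  no-mutual-override p p-wins ∼p-wins (r , c , app) =
    no-endless-ascent (acyclic D) Contested ascend (r , inj₁ c , app)
    where
    Contested : R → Set
    Contested x = (C x ≡ p ⊎ C x ≡ ∼ p) × Applicable x

    ascend : ∀ x → Contested x → Σ R λ y → y > x × Contested y
    ascend x (inj₁ cp , app)
      with t , ct , t>x , app′ ← ∼p-wins x (trans cp (sym (∼-involutive p))) app
      = t , t>x , inj₂ ct , app′
    ascend x (inj₂ c∼p , app)
      with t , ct , t>x , app′ ← p-wins x c∼p app
      = t , t>x , inj₁ ct , app′

propositionC1 : {Atom : Set} (D : Theory Atom) (p : Lit Atom) →
    ((¬ PΔ D (plus , p) → PΔ D (plus , ∼ p) → ¬ P∂ D (plus , p))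
    × (PΔ D (minus , p) → PΔ D (plus , ∼ p) → P∂ D (minus , p))
    × (¬ PΔ D (plus , p) → ¬ PΔ D (plus , ∼ p) →
         ¬ (P∂ D (plus , p) × P∂ D (plus , ∼ p))))
propositionC1 D p = part1 , part2 , part3
  where
  part1 : ¬ PΔ D (plus , p) → PΔ D (plus , ∼ p) → ¬ P∂ D (plus , p)
  part1 not-Δp Δ∼p ∂p = proj₁ (∂⁺-inversion D ∂p not-Δp) Δ∼p

  -- a one-step proof by clause 2.2
  part2 : PΔ D (minus , p) → PΔ D (plus , ∼ p) → P∂ D (minus , p)
  part2 -Δp Δ∼p = _ , (-Δp , inj₂ (inj₁ Δ∼p)) ∷ [] , here refl

  part3 : ¬ PΔ D (plus , p) → ¬ PΔ D (plus , ∼ p) → ¬ (P∂ D (plus , p) × P∂ D (plus , ∼ p))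
  part3 not-Δp not-Δ∼p (∂p , ∂∼p)
    with _ , applicable , p-wins ← ∂⁺-inversion D ∂p not-Δp
       | _ , _ , ∼p-wins ← ∂⁺-inversion D ∂∼p not-Δ∼p
    = no-mutual-override D p p-wins ∼p-wins applicable
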